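{- Let $B$ be a bicyclic graph of order $n$ and maximum degree $\Delta$ such that $n \equiv p \pmod{\Delta-1}$, where $p$ is an integer with $2\le p<\Delta-3$. Then $$F(B)\le (\Delta^2+\Delta+2)\,n-p(\Delta^2+\Delta+2)+p^3+9p^2+28p+26.$$
   Context: All graphs are finite and simple. For a graph $G$ with vertex set $V$ and edge set $E$, the order is $n=|V|$ and the size is $m=|E|$; $G$ is called bicyclic if $m=n+1$. The degree of a vertex $v$ is $d(v)$, and $\Delta$ denotes the maximum degree of $G$. The forgotten topological index (F-index) of $G$ is $F(G)=\sum_{uv\in E}\left(d(u)^2+d(v)^2\right)=\sum_{v\in V} d(v)^3$. -}

module Defs where

open import Data.Bool using (Bool; true; false; if_then_else_)
open import Data.Nat using (ℕ; _^_; _⊔_)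
open import Data.Fin using (Fin; toℕ)
open import Data.List using (List; map; foldr; allFin)
open import Data.Nat.ListAction using (sum)
open import Data.Product using (_×_)
open import Data.Nat using (_+_)
open import Data.Nat using (_<ᵇ_)
open import Relation.Binary.PropositionalEquality using (_≡_)

record SimpleGraph (n : ℕ) : Set where
  field
    adj    : Fin n → Fin n → Bool
    sym    : ∀ u v → adj u v ≡ adj v u
    irrefl : ∀ v → adj v v ≡ false
open SimpleGraph public

count : ∀ {n} → (Fin n → Bool) → ℕ
count {n} P = sum (map (λ j → if P j then 1 else 0) (allFin n))

degree : ∀ {n} → SimpleGraph n → Fin n → ℕ
degree G v = count (adj G v)

size : ∀ {n} → SimpleGraph n → ℕ
size {n} G = sum (map (λ u → count (λ v → if toℕ u <ᵇ toℕ v then adj G u v else false)) (allFin n))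

maxDegree : ∀ {n} → SimpleGraph n → ℕ
maxDegree {n} G = foldr _⊔_ 0 (map (degree G) (allFin n))

fIndex : ∀ {n} → SimpleGraph n → ℕ
fIndex {n} G = sum (map (λ v → degree G v ^ 3) (allFin n))

data Reachable {n} (G : SimpleGraph n) : Fin n → Fin n → Set where
  here : ∀ {v} → Reachable G v v
  step : ∀ {u w v} → adj G u w ≡ true → Reachable G w v → Reachable G u v

Connected : ∀ {n} → SimpleGraph n → Set
Connected {n} G = ∀ (u v : Fin n) → Reachable G u v

Bicyclic : ∀ {n} → SimpleGraph n → Set
Bicyclic {n} G = Connected G × (size G ≡ n + 1)

module Submission where

-- Write d(v) = 1 + x(v). Connectivity gives d(v) ≥ 1, so 0 ≤ x(v) ≤ Δ − 1, the handshake lemma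
-- gives Σ x(v) = 2(n + 1) − n = n + 2, and F(B) = n + Σ h(x(v)) with h(x) = (1 + x)³ − 1.
-- Since h is convex with h(0) = 0, merging two values whose sum stays below Δ − 1, or replacing
-- a pair (y, r) by (y + r − (Δ − 1), Δ − 1), never decreases Σ h; so Σ h(x(v)) ≤ q h(Δ − 1) + h(r)
-- where n + 2 = q (Δ − 1) + r with r < Δ − 1. As n ≡ p and p + 2 < Δ − 1, this division has
-- remainder r = p + 2, and the resulting bound expands to the stated polynomial.

open import Defs renaming (sym to adj-sym; irrefl to adj-irrefl)

module _ where

  open import Data.Nat
  open import Data.Nat.Properties
  open import Data.Nat.DivMod using (_%_; [m+kn]%n≡m%n; m<n⇒m%n≡m)
  open import Data.Bool using (Bool; true; false; if_then_else_; T)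
  open import Data.Fin as Fin using (Fin; toℕ)
  open import Data.Fin.Properties using (toℕ-injective)
  import Data.List as List
  open import Data.List using ([]; _∷_)
  open import Data.List.Properties using (map-tabulate)
  open import Data.Nat.ListAction using (sum)
  open import Data.Vec.Functional as Vector using (Vector; head; tail)
  open import Data.Product using (∃; ∃₂; _×_; _,_)
  open import Data.Unit using (tt)
  open import Function using (_∘_)
  open import Relation.Nullary using (yes; no; contradiction)
  open import Relation.Binary.PropositionalEquality
  open import Algebra.Properties.CommutativeSemigroup +-commutativeSemigroup
    using (x∙yz≈y∙zx; x∙yz≈y∙xz; x∙yz≈yx∙z; x∙yz≈zx∙y)
  open import Algebra.Properties.CommutativeMonoid.Sum +-0-commutativeMonoid
    using (sum-syntax; sum-cong-≗; ∑-distrib-+; ∑-comm)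
    renaming (sum to ∑)
  open import Data.Nat.Tactic.RingSolver using (solve; solve-∀)

  foldr-tabulate : ∀ {A B : Set} (g : A → B → B) (e : B) {n} (f : Fin n → A) →
                   List.foldr g e (List.tabulate f) ≡ Vector.foldr g e f
  foldr-tabulate g e {zero} f = refl
  foldr-tabulate g e {suc n} f = cong (g (f Fin.zero)) (foldr-tabulate g e (f ∘ Fin.suc))

  foldr-map-allFin : ∀ {A B : Set} (g : A → B → B) (e : B) {n} (f : Fin n → A) →
                     List.foldr g e (List.map f (List.allFin n)) ≡ Vector.foldr g e f
  foldr-map-allFin g e f = trans (cong (List.foldr g e) (map-tabulate (λ i → i) f)) (foldr-tabulate g e f)

  sum-map-allFin : ∀ {n} (f : Vector ℕ n) → sum (List.map f (List.allFin n)) ≡ ∑ f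
  sum-map-allFin = foldr-map-allFin _+_ 0

  lookup≤∑ : ∀ {n} (f : Vector ℕ n) i → f i ≤ ∑ f
  lookup≤∑ f Fin.zero = m≤m+n (f Fin.zero) _
  lookup≤∑ f (Fin.suc i) = ≤-trans (lookup≤∑ (tail f) i) (m≤n+m _ (head f))

  lookup≤⊔ : ∀ {n} (f : Vector ℕ n) i → f i ≤ Vector.foldr _⊔_ 0 f
  lookup≤⊔ f Fin.zero = m≤m⊔n (f Fin.zero) _
  lookup≤⊔ f (Fin.suc i) = ≤-trans (lookup≤⊔ (tail f) i) (m≤n⊔m (head f) _)

  ∑>0⇒∃>0 : ∀ {n} (f : Vector ℕ n) → 0 < ∑ f → ∃ λ i → 0 < f i
  ∑>0⇒∃>0 {suc n} f ∑f>0 with f Fin.zero in f₀≡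
  ... | zero = let i , fi>0 = ∑>0⇒∃>0 (tail f) ∑f>0 in Fin.suc i , fi>0
  ... | suc _ = Fin.zero , subst (0 <_) (sym f₀≡) z<s

  ∑-suc : ∀ {n} (f : Vector ℕ n) → ∑[ i < n ] suc (f i) ≡ n + ∑ f
  ∑-suc {zero} f = refl
  ∑-suc {suc n} f = cong suc (trans (cong (head f +_) (∑-suc (tail f))) (x∙yz≈y∙xz (head f) n _))

  *+-unique : ∀ {E} .{{_ : NonZero E}} {q r q′ r′} → r < E → r′ < E →
              q * E + r ≡ q′ * E + r′ → q ≡ q′ × r ≡ r′
  *+-unique {E} {q} {r} {q′} {r′} r<E r′<E eq = q≡q′ , r≡r′
    where
    remainder : ∀ q {r} → r < E → (q * E + r) % E ≡ r
    remainder q {r} r<E = trans (cong (_% E) (+-comm (q * E) r)) (trans ([m+kn]%n≡m%n r q E) (m<n⇒m%n≡m r<E))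
    r≡r′ : r ≡ r′
    r≡r′ = trans (sym (remainder q r<E)) (trans (cong (_% E) eq) (remainder q′ r′<E))
    q≡q′ : q ≡ q′
    q≡q′ = *-cancelʳ-≡ q q′ E (+-cancelʳ-≡ r _ _ (trans eq (cong (q′ * E +_) (sym r≡r′))))

  -- Two-point form of discrete convexity: moving y, r apart to e ≤ y ≤ E with e + E = y + r
  -- does not decrease the sum of the h-values.
  Convex : (ℕ → ℕ) → Set
  Convex h = ∀ {e y r E} → e ≤ y → y ≤ E → e + E ≡ y + r → h y + h r ≤ h e + h E

  module _ (h : ℕ → ℕ) (h0≡0 : h 0 ≡ 0) (convex : Convex h) {E : ℕ} .{{_ : NonZero E}} where

    superadditive : ∀ x y → h x + h y ≤ h (x + y)
    superadditive x y = subst (h x + h y ≤_) (cong (_+ h (x + y)) h0≡0) (convex z≤n (m≤m+n x y) refl)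

    carry : ∀ {y q r} → y ≤ E → r < E →
            ∃₂ λ q′ r′ → r′ < E × y + (q * E + r) ≡ q′ * E + r′ × h y + (q * h E + h r) ≤ q′ * h E + h r′
    carry {y} {q} {r} y≤E r<E with r + y <? E
    ... | yes r+y<E = q , r + y , r+y<E , sum≡ , bound
      where
      sum≡ : y + (q * E + r) ≡ q * E + (r + y)
      sum≡ = x∙yz≈y∙zx y (q * E) r
      bound : h y + (q * h E + h r) ≤ q * h E + h (r + y)
      bound = begin
        h y + (q * h E + h r)  ≡⟨ x∙yz≈y∙zx (h y) (q * h E) (h r) ⟩
        q * h E + (h r + h y)  ≤⟨ +-monoʳ-≤ (q * h E) (superadditive r y) ⟩
        q * h E + h (r + y)    ∎
        where open ≤-Reasoning
    ... | no r+y≮E with m≤n⇒∃[o]m+o≡n (≮⇒≥ r+y≮E)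
    ...   | e , E+e≡r+y = suc q , e , <-≤-trans e<y y≤E , sum≡ , bound
      where
      e<y : e < y
      e<y = +-cancelˡ-< E e y (subst (_< E + y) (sym E+e≡r+y) (+-monoˡ-< y r<E))
      e+E≡y+r : e + E ≡ y + r
      e+E≡y+r = trans (+-comm e E) (trans E+e≡r+y (+-comm r y))
      sum≡ : y + (q * E + r) ≡ suc q * E + e
      sum≡ = begin
        y + (q * E + r)  ≡⟨ x∙yz≈y∙zx y (q * E) r ⟩
        q * E + (r + y)  ≡⟨ cong (q * E +_) E+e≡r+y ⟨
        q * E + (E + e)  ≡⟨ x∙yz≈yx∙z (q * E) E e ⟩
        suc q * E + e    ∎
        where open ≡-Reasoning
      bound : h y + (q * h E + h r) ≤ suc q * h E + h e
      bound = begin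
        h y + (q * h E + h r)  ≡⟨ x∙yz≈y∙xz (h y) (q * h E) (h r) ⟩
        q * h E + (h y + h r)  ≤⟨ +-monoʳ-≤ (q * h E) (convex (<⇒≤ e<y) y≤E e+E≡y+r) ⟩
        q * h E + (h e + h E)  ≡⟨ x∙yz≈zx∙y (q * h E) (h e) (h E) ⟩
        suc q * h E + h e      ∎
        where open ≤-Reasoning

    ∑-bound : ∀ {m} (ys : Vector ℕ m) → (∀ i → ys i ≤ E) →
              ∃₂ λ q r → r < E × ∑[ i < m ] ys i ≡ q * E + r × ∑[ i < m ] h (ys i) ≤ q * h E + h r
    ∑-bound {zero} ys _ = 0 , 0 , >-nonZero⁻¹ E , refl , z≤n
    ∑-bound {suc m} ys ys≤E with ∑-bound (tail ys) (ys≤E ∘ Fin.suc)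
    ... | q , r , r<E , sum≡ , bound with carry {q = q} (ys≤E Fin.zero) r<E
    ...   | q′ , r′ , r′<E , sum≡′ , bound′ =
      q′ , r′ , r′<E , trans (cong (head ys +_) sum≡) sum≡′ , ≤-trans (+-monoʳ-≤ (h (head ys)) bound) bound′

    ∑h≤q*hE+hr : ∀ {m} (ys : Vector ℕ m) → (∀ i → ys i ≤ E) → ∀ q {r} → r < E →
                 ∑[ i < m ] ys i ≡ q * E + r → ∑[ i < m ] h (ys i) ≤ q * h E + h r
    ∑h≤q*hE+hr ys ys≤E q {r} r<E sum≡ with ∑-bound ys ys≤E
    ... | q′ , r′ , r′<E , sum≡′ , bound with *+-unique {q = q′} {r′} {q} {r} r′<E r<E (trans (sym sum≡′) sum≡)
    ...   | refl , refl = bound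

  -- (1 + y)³ − 1, written without truncated subtraction.
  shiftedCube : ℕ → ℕ
  shiftedCube y = y * y * y + 3 * (y * y) + 3 * y

  suc^3≡suc-shiftedCube : ∀ y → suc y ^ 3 ≡ suc (shiftedCube y)
  suc^3≡suc-shiftedCube = expand
    where
    -- The ring solvers do not accept _^_, so the power is unfolded.
    expand : ∀ y → suc y * (suc y * (suc y * 1)) ≡ suc (y * y * y + 3 * (y * y) + 3 * y)
    expand = solve-∀

  shiftedCube-convex : Convex shiftedCube
  shiftedCube-convex {e} {y} {r} {E} e≤y y≤E e+E≡y+r with m≤n⇒∃[o]m+o≡n e≤y | m≤n⇒∃[o]m+o≡n y≤E
  ... | b , refl | a , refl = begin
    h (e + b) + h r                                              ≡⟨ cong (λ z → h (e + b) + h z) r≡e+a ⟩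
    h (e + b) + h (e + a)                                        ≤⟨ m≤m+n _ _ ⟩
    h (e + b) + h (e + a) + 3 * ((e + e + a + b + 2) * (a * b))  ≡⟨ exchange e a b ⟩
    h e + h (e + b + a)                                          ∎
    where
    open ≤-Reasoning
    h = shiftedCube
    r≡e+a : r ≡ e + a
    r≡e+a = +-cancelˡ-≡ (e + b) r (e + a) (trans (sym e+E≡y+r) (solve (e ∷ b ∷ a ∷ [])))
    exchange : ∀ e a b → let y = e + b; r = e + a; E = e + b + a in
      y * y * y + 3 * (y * y) + 3 * y + (r * r * r + 3 * (r * r) + 3 * r) + 3 * ((e + e + a + b + 2) * (a * b))
      ≡ e * e * e + 3 * (e * e) + 3 * e + (E * E * E + 3 * (E * E) + 3 * E)
    exchange = solve-∀

  ind : Bool → ℕ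
  ind b = if b then 1 else 0

  ind>0⇒≡true : ∀ {b} → 0 < ind b → b ≡ true
  ind>0⇒≡true {true} _ = refl

  <ᵇ≡false⇒≥ : ∀ {m n} → (m <ᵇ n) ≡ false → n ≤ m
  <ᵇ≡false⇒≥ {m} {n} m≮ᵇn = ≮⇒≥ (λ m<n → subst T m≮ᵇn (<⇒<ᵇ m<n))

  module _ {n} (G : SimpleGraph n) where

    lowerAdj : Fin n → Fin n → Bool
    lowerAdj u v = if toℕ u <ᵇ toℕ v then adj G u v else false

    degree≡∑ : ∀ v → degree G v ≡ ∑[ w < n ] ind (adj G v w)
    degree≡∑ v = sum-map-allFin (ind ∘ adj G v)

    size≡∑∑ : size G ≡ ∑[ u < n ] ∑[ v < n ] ind (lowerAdj u v)
    size≡∑∑ = trans (sum-map-allFin (λ u → count (lowerAdj u)))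
                    (sum-cong-≗ λ u → sum-map-allFin (ind ∘ lowerAdj u))

    ind-adj-split : ∀ u v → ind (adj G u v) ≡ ind (lowerAdj u v) + ind (lowerAdj v u)
    ind-adj-split u v with toℕ u <ᵇ toℕ v in u<ᵇv | toℕ v <ᵇ toℕ u in v<ᵇu
    ... | true  | true  =
      contradiction (<ᵇ⇒< (toℕ u) (toℕ v) (subst T (sym u<ᵇv) tt))
                    (<-asym (<ᵇ⇒< (toℕ v) (toℕ u) (subst T (sym v<ᵇu) tt)))
    ... | true  | false = sym (+-identityʳ _)
    ... | false | true  = cong ind (adj-sym G u v)
    ... | false | false = cong ind (trans (cong (λ x → adj G x v) u≡v) (adj-irrefl G v))
      where
      u≡v : u ≡ v
      u≡v = toℕ-injective (≤-antisym (<ᵇ≡false⇒≥ v<ᵇu) (<ᵇ≡false⇒≥ u<ᵇv))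

    handshake : ∑[ v < n ] degree G v ≡ size G + size G
    handshake = begin
      ∑[ u < n ] degree G u
        ≡⟨ sum-cong-≗ degree≡∑ ⟩
      ∑[ u < n ] ∑[ v < n ] ind (adj G u v)
        ≡⟨ sum-cong-≗ (λ u → sum-cong-≗ (ind-adj-split u)) ⟩
      ∑[ u < n ] ∑[ v < n ] (L u v + L v u)
        ≡⟨ sum-cong-≗ (λ u → ∑-distrib-+ (L u) (λ v → L v u)) ⟩
      ∑[ u < n ] (∑[ v < n ] L u v + ∑[ v < n ] L v u)
        ≡⟨ ∑-distrib-+ (λ u → ∑[ v < n ] L u v) (λ u → ∑[ v < n ] L v u) ⟩
      ∑[ u < n ] ∑[ v < n ] L u v + ∑[ u < n ] ∑[ v < n ] L v u
        ≡⟨ cong₂ _+_ (sym size≡∑∑) (trans (∑-comm (λ u v → L v u)) (sym size≡∑∑)) ⟩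
      size G + size G  ∎
      where
      open ≡-Reasoning
      L : Fin n → Fin n → ℕ
      L u v = ind (lowerAdj u v)

    size>0⇒edge : 0 < size G → ∃₂ λ u v → adj G u v ≡ true
    size>0⇒edge size>0 with ∑>0⇒∃>0 _ (subst (0 <_) size≡∑∑ size>0)
    ... | u , count>0 with ∑>0⇒∃>0 _ count>0
    ...   | v , uv>0 = u , v , lowerAdj⇒adj (ind>0⇒≡true uv>0)
      where
      lowerAdj⇒adj : lowerAdj u v ≡ true → adj G u v ≡ true
      lowerAdj⇒adj with toℕ u <ᵇ toℕ v
      ... | true  = λ uv → uv
      ... | false = λ ()

    adj⇒degree>0 : ∀ {v w} → adj G v w ≡ true → 0 < degree G v
    adj⇒degree>0 {v} {w} vw = begin-strict
      0                           <⟨ z<s ⟩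
      1                           ≡⟨ cong ind vw ⟨
      ind (adj G v w)             ≤⟨ lookup≤∑ _ w ⟩
      ∑[ x < n ] ind (adj G v x)  ≡⟨ degree≡∑ v ⟨
      degree G v                  ∎
      where open ≤-Reasoning

    connected⇒degree>0 : Connected G → ∀ {u w} → adj G u w ≡ true → ∀ v → 0 < degree G v
    connected⇒degree>0 conn {u} uw v with v Fin.≟ u | conn v u
    ... | yes refl | _             = adj⇒degree>0 uw
    ... | no v≢u   | here          = contradiction refl v≢u
    ... | no _     | step vw′ _    = adj⇒degree>0 vw′

    degree≤maxDegree : ∀ v → degree G v ≤ maxDegree G
    degree≤maxDegree v = subst (degree G v ≤_) (sym (foldr-map-allFin _⊔_ 0 (degree G))) (lookup≤⊔ _ v)

  module _ {n} (G : SimpleGraph n) (conn : Connected G) (size>0 : 0 < size G) {E} (Δ≡ : maxDegree G ≡ suc E) where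

    private
      degree>0 : ∀ v → 0 < degree G v
      degree>0 = let u , w , uw = size>0⇒edge G size>0 in connected⇒degree>0 G conn uw

      excess : Fin n → ℕ
      excess v = pred (degree G v)

      suc-excess : ∀ v → suc (excess v) ≡ degree G v
      suc-excess v = suc-pred (degree G v) {{>-nonZero (degree>0 v)}}

      excess≤E : ∀ v → excess v ≤ E
      excess≤E v = pred-mono-≤ (subst (degree G v ≤_) Δ≡ (degree≤maxDegree G v))

      ∑degree : ∑[ v < n ] degree G v ≡ n + ∑ excess
      ∑degree = trans (sum-cong-≗ (sym ∘ suc-excess)) (∑-suc excess)

      fIndex≡ : fIndex G ≡ n + ∑[ v < n ] shiftedCube (excess v)
      fIndex≡ = begin
        fIndex G                                   ≡⟨ sum-map-allFin (λ v → degree G v ^ 3) ⟩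
        ∑[ v < n ] (degree G v ^ 3)                ≡⟨ sum-cong-≗ (λ v → cong (_^ 3) (suc-excess v)) ⟨
        ∑[ v < n ] (suc (excess v) ^ 3)            ≡⟨ sum-cong-≗ (suc^3≡suc-shiftedCube ∘ excess) ⟩
        ∑[ v < n ] suc (shiftedCube (excess v))    ≡⟨ ∑-suc (shiftedCube ∘ excess) ⟩
        n + ∑[ v < n ] shiftedCube (excess v)      ∎
        where open ≡-Reasoning

    fIndex≤ : ∀ q {r} → r < E → size G + size G ≡ n + (q * E + r) →
              fIndex G ≤ n + (q * shiftedCube E + shiftedCube r)
    fIndex≤ q {r} r<E 2size≡ = begin
      fIndex G                                ≡⟨ fIndex≡ ⟩
      n + ∑[ v < n ] shiftedCube (excess v)
        ≤⟨ +-monoʳ-≤ n (∑h≤q*hE+hr shiftedCube refl shiftedCube-convex excess excess≤E q r<E ∑excess) ⟩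
      n + (q * shiftedCube E + shiftedCube r) ∎
      where
      open ≤-Reasoning
      instance
        E≢0 : NonZero E
        E≢0 = >-nonZero (<-≤-trans z<s r<E)
      ∑excess : ∑ excess ≡ q * E + r
      ∑excess = +-cancelˡ-≡ n _ _ (trans (sym ∑degree) (trans (handshake G) 2size≡))

  bicyclic-fIndex≤ : ∀ {n} (G : SimpleGraph n) → Bicyclic G → ∀ {E k p} → maxDegree G ≡ suc E →
                     n ≡ k * E + p → p + 2 < E → fIndex G ≤ n + (k * shiftedCube E + shiftedCube (p + 2))
  bicyclic-fIndex≤ {n} G (conn , size≡) {E} {k} {p} Δ≡ n≡ p+2<E = fIndex≤ G conn size>0 Δ≡ k p+2<E 2size≡
    where
    size>0 : 0 < size G
    size>0 = subst (0 <_) (trans (+-comm 1 n) (sym size≡)) z<s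
    2size≡ : size G + size G ≡ n + (k * E + (p + 2))
    2size≡ = begin
      size G + size G      ≡⟨ cong₂ _+_ size≡ size≡ ⟩
      n + 1 + (n + 1)      ≡⟨ solve (n ∷ []) ⟩
      n + (n + 2)          ≡⟨ cong (λ m → n + (m + 2)) n≡ ⟩
      n + (k * E + p + 2)  ≡⟨ cong (n +_) (+-assoc (k * E) p 2) ⟩
      n + (k * E + (p + 2)) ∎
      where open ≡-Reasoning


open import Data.Nat using (ℕ; zero; suc)
import Data.Nat as ℕ
import Data.Nat.Properties as ℕ
open import Data.Integer using (ℤ; +_; _+_; _-_; _*_; _≤_; _<_; _^_)
open import Data.Integer using (∣_∣; +≤+; +<+)
open import Data.Integer.Properties using (pos-*; m-n≡m⊖n; ⊖-≥; ∣⊖∣-<; module ≤-Reasoning)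
open import Data.Integer.Divisibility using (_∣_; divides)
open import Data.Integer.Tactic.RingSolver using (solve-∀)
open import Data.Product using (_×_; ∃; _,_)
open import Relation.Nullary using (yes; no; contradiction)
open import Relation.Binary.PropositionalEquality

E∣n-p⇒n≡k*E+p : ∀ {E n p} → p ℕ.< E → + E ∣ + n - + p → ∃ λ k → n ≡ k ℕ.* E ℕ.+ p
E∣n-p⇒n≡k*E+p {E} {n} {p} p<E (divides k ∣n-p∣≡k*E) with p ℕ.≤? n
... | yes p≤n = k , (begin
  n              ≡⟨ ℕ.m∸n+n≡m p≤n ⟨
  n ℕ.∸ p ℕ.+ p  ≡⟨ cong (ℕ._+ p) (trans (sym (cong ∣_∣ (trans (m-n≡m⊖n n p) (⊖-≥ p≤n)))) ∣n-p∣≡k*E) ⟩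
  k ℕ.* E ℕ.+ p  ∎)
  where open ≡-Reasoning
... | no p≰n = contradiction (p∸n≡k*E⇒p≤n k p∸n≡k*E) p≰n
  where
  p∸n≡k*E : p ℕ.∸ n ≡ k ℕ.* E
  p∸n≡k*E = trans (sym (∣⊖∣-< (ℕ.≰⇒> p≰n))) (trans (cong ∣_∣ (sym (m-n≡m⊖n n p))) ∣n-p∣≡k*E)
  -- k * E ≤ p < E forces k = 0.
  p∸n≡k*E⇒p≤n : ∀ k → p ℕ.∸ n ≡ k ℕ.* E → p ℕ.≤ n
  p∸n≡k*E⇒p≤n zero    p∸n≡0 = ℕ.m∸n≡0⇒m≤n p∸n≡0
  p∸n≡k*E⇒p≤n (suc k) p∸n≡  =
    contradiction (ℕ.≤-trans (ℕ.m≤m+n E (k ℕ.* E)) (ℕ.≤-trans (ℕ.≤-reflexive (sym p∸n≡)) (ℕ.m∸n≤m p n))) (ℕ.<⇒≱ p<E)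

bicyclicBound : ℤ → ℤ → ℤ → ℤ
bicyclicBound Δ n p = let c = Δ ^ 2 + Δ + + 2 in c * n - p * c + p ^ 3 + + 9 * p ^ 2 + + 28 * p + + 26

shiftedCubeℤ : ℤ → ℤ
shiftedCubeℤ y = y * y * y + + 3 * (y * y) + + 3 * y

pos-shiftedCube : ∀ y → + shiftedCube y ≡ shiftedCubeℤ (+ y)
pos-shiftedCube y = cong₂ _+_ (cong₂ _+_ (trans (pos-* (y ℕ.* y) y) (cong (_* + y) (pos-* y y)))
                                         (trans (pos-* 3 (y ℕ.* y)) (cong (+ 3 *_) (pos-* y y))))
                              (pos-* 3 y)

bicyclicBound≡ : ∀ {n k E p} → n ≡ k ℕ.* E ℕ.+ p →
                 bicyclicBound (+ suc E) (+ n) (+ p) ≡ + (n ℕ.+ (k ℕ.* shiftedCube E ℕ.+ shiftedCube (p ℕ.+ 2)))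
bicyclicBound≡ {k = k} {E} {p} refl = begin
  bicyclicBound (+ suc E) (+ (k ℕ.* E ℕ.+ p)) (+ p)
    ≡⟨ cong (λ kE → bicyclicBound (+ suc E) (kE + + p) (+ p)) (pos-* k E) ⟩
  bicyclicBound (+ 1 + + E) (+ k * + E + + p) (+ p)
    ≡⟨ polynomial (+ k) (+ E) (+ p) ⟩
  + k * + E + + p + (+ k * shiftedCubeℤ (+ E) + shiftedCubeℤ (+ p + + 2))
    ≡⟨ cong₂ (λ kE c → kE + + p + c) (pos-* k E)
             (cong₂ _+_ (trans (pos-* k _) (cong (+ k *_) (pos-shiftedCube E))) (pos-shiftedCube (p ℕ.+ 2))) ⟨
  + (k ℕ.* E ℕ.+ p ℕ.+ (k ℕ.* shiftedCube E ℕ.+ shiftedCube (p ℕ.+ 2)))  ∎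
  where
  open ≡-Reasoning
  -- Powers unfolded, as for suc^3≡suc-shiftedCube.
  polynomial : ∀ k E p →
    let Δ = + 1 + E
        c = Δ * (Δ * + 1) + Δ + + 2
        q = p + + 2
    in c * (k * E + p) - p * c + p * (p * (p * + 1)) + + 9 * (p * (p * + 1)) + + 28 * p + + 26
       ≡ k * E + p + (k * (E * E * E + + 3 * (E * E) + + 3 * E) + (q * q * q + + 3 * (q * q) + + 3 * q))
  polynomial = solve-∀

p<Δ-3⇒ : ∀ {Δ p} → + p < + Δ - + 3 → ∃ λ E → Δ ≡ suc E × p ℕ.+ 2 ℕ.< E
p<Δ-3⇒ {0} ()
p<Δ-3⇒ {1} ()
p<Δ-3⇒ {2} ()
p<Δ-3⇒ {3} (+<+ ())
p<Δ-3⇒ {suc (suc (suc (suc m)))} {p} (+<+ p<1+m) =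
  3 ℕ.+ m , refl , subst (p ℕ.+ 2 ℕ.<_) (ℕ.+-comm (suc m) 2) (ℕ.+-monoˡ-< 2 p<1+m)

mainTheorem3 : ∀ (n : ℕ) (B : SimpleGraph n) (p : ℤ) →
    Bicyclic B →
    (+ (maxDegree B) - + 1) ∣ (+ n - p) →
    + 2 ≤ p → p < + (maxDegree B) - + 3 →
    let Δ = + (maxDegree B)
        c = Δ ^ 2 + Δ + + 2
    in + (fIndex B) ≤ c * + n - p * c + p ^ 3 + + 9 * p ^ 2 + + 28 * p + + 26
mainTheorem3 n B (+ p) bic Δ-1∣n-p (+≤+ _) p<Δ-3 with p<Δ-3⇒ p<Δ-3
... | E , Δ≡ , p+2<E
  with E∣n-p⇒n≡k*E+p (ℕ.m+n≤o⇒m≤o (suc p) p+2<E) (subst (λ Δ → (+ Δ - + 1) ∣ (+ n - + p)) Δ≡ Δ-1∣n-p)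
... | k , n≡ = subst (λ Δ → + fIndex B ≤ bicyclicBound (+ Δ) (+ n) (+ p)) (sym Δ≡) (begin
  + fIndex B                                                ≤⟨ +≤+ (bicyclic-fIndex≤ B bic {k = k} Δ≡ n≡ p+2<E) ⟩
  + (n ℕ.+ (k ℕ.* shiftedCube E ℕ.+ shiftedCube (p ℕ.+ 2)))  ≡⟨ bicyclicBound≡ {k = k} n≡ ⟨
  bicyclicBound (+ suc E) (+ n) (+ p)                        ∎)
  where open ≤-Reasoning
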